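{- Let $n\ge k\ge 2$ be integers. Let $M$ be a $k\times n$ MDS matrix (over a field) all of whose entries lie in a finite set $\Sigma$. Then $|\Sigma|\ge \sqrt{n/k}$.
   Context: For $n\ge k$, a $k\times n$ matrix is called an MDS matrix if any $k$ of its columns are linearly independent; equivalently, every $k\times k$ minor of it is nonsingular. -}

module Defs where

open import Level using (Level; _⊔_; suc)
open import Data.Nat using (ℕ; zero; suc)
import Data.Fin as Fin
open Fin using (Fin)
open import Data.Product using (∃)
open import Relation.Nullary using (¬_)
open import Relation.Binary.PropositionalEquality using (_≡_)
open import Function.Definitions using (Injective)
open import Algebra.Bundles using (CommutativeRing)

record Field (c ℓ : Level) : Set (Level.suc (c ⊔ ℓ)) where
  field
    commutativeRing : CommutativeRing c ℓ
  open CommutativeRing commutativeRing public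
  field
    0≉1     : ¬ (0# ≈ 1#)
    inverse : ∀ x → ¬ (x ≈ 0#) → ∃ λ y → (x * y) ≈ 1#

module _ {c ℓ : Level} (F : Field c ℓ) where
  open Field F using (Carrier; _≈_; _+_; _*_; 0#)

  sumFin : (m : ℕ) → (Fin m → Carrier) → Carrier
  sumFin zero    f = 0#
  sumFin (suc m) f = f Fin.zero + sumFin m (λ j → f (Fin.suc j))

  -- A k×n matrix M (rows Fin k, columns Fin n) is MDS if any k of its
  -- columns are linearly independent: for every choice of k distinct
  -- columns s : Fin k → Fin n (injective), the only linear combination
  -- Σ_j c_j · (column s_j) that vanishes is the trivial one.
  IsMDS : (k n : ℕ) → (Fin k → Fin n → Carrier) → Set (c ⊔ ℓ)
  IsMDS k n M =
    (s : Fin k → Fin n) → Injective _≡_ _≡_ s →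
    (coef : Fin k → Carrier) →
    (∀ i → sumFin k (λ j → coef j * M i (s j)) ≈ 0#) →
    ∀ j → coef j ≈ 0#

module Submission where

-- Record for each column the indices in σ of its entries in the first two rows. There are only
-- m² such pairs, so if n > k m² the pigeonhole principle yields k columns on which both rows are
-- constant (already n > (k − 1) m² suffices). Subtracting the first of these columns from the
-- others leaves k − 1 vectors vanishing in two coordinates, i.e. lying in a (k − 2)-dimensional
-- space; they are dependent, hence so are the k columns, contradicting the MDS property.

open import Defs
open import Level using (Level)

module Pigeonhole where

  open import Data.Nat using (ℕ; zero; suc; _+_; _*_; _<_; _<?_)
  open import Data.Nat.Properties
    using (_≟_; ≤∧≢⇒<; m<1+n⇒m≤n; n≮0; *-suc; *-zeroʳ; +-suc; +-cancelˡ-<; +-monoˡ-≤; ≮⇒≥; module ≤-Reasoning)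
  open import Data.Fin using (Fin; zero; suc; toℕ; inject≤)
  open import Data.Fin.Properties using (toℕ<n; toℕ-injective; inject≤-injective)
  open import Data.List using (List; []; _∷_; length; filter; lookup)
  open import Data.List.Properties using (length-tabulate)
  open import Data.List.Membership.Propositional.Properties using (∈-lookup)
  open import Data.List.Relation.Unary.All as All using (All; _∷_)
  open import Data.List.Relation.Unary.All.Properties using (all-filter; filter⁺; tabulate⁺)
  open import Data.List.Relation.Unary.AllPairs using (_∷_)
  open import Data.List.Relation.Unary.Unique.Propositional using (Unique)
  import Data.List.Relation.Unary.Unique.Propositional.Properties as Unique
  open import Data.Product using (∃; _×_; _,_)
  open import Function using (_∘_)
  open import Function.Definitions using (Injective)
  open import Relation.Nullary using (yes; no; contradiction)
  open import Relation.Unary using (Pred; Decidable)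
  open import Relation.Unary.Properties using (∁?)
  open import Relation.Binary.PropositionalEquality using (_≡_; _≢_; refl; sym; trans; cong; subst)

  module _ {a} {A : Set a} where

    length-filter+∁ : ∀ {p} {P : Pred A p} (P? : Decidable P) xs →
      length xs ≡ length (filter P? xs) + length (filter (∁? P?) xs)
    length-filter+∁ P? []       = refl
    length-filter+∁ P? (x ∷ xs) with P? x
    ... | yes _ = cong suc (length-filter+∁ P? xs)
    ... | no  _ = trans (cong suc (length-filter+∁ P? xs)) (sym (+-suc _ _))

    lookup-injective : ∀ {xs : List A} → Unique xs → Injective _≡_ _≡_ (lookup xs)
    lookup-injective (x≢xs ∷ _) {zero}  {zero}  _  = refl
    lookup-injective (x≢xs ∷ _) {zero}  {suc j} eq = contradiction eq (All.lookup x≢xs (∈-lookup j))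
    lookup-injective (x≢xs ∷ _) {suc i} {zero}  eq = contradiction (sym eq) (All.lookup x≢xs (∈-lookup i))
    lookup-injective (_ ∷ uniq) {suc i} {suc j} eq = cong suc (lookup-injective uniq eq)

    pigeonhole-fibre : ∀ (g : A → ℕ) p t {xs} → Unique xs → All (λ x → g x < p) xs → t * p < length xs →
      ∃ λ c → ∃ λ ys → Unique ys × t < length ys × All (λ y → g y ≡ c) ys
    pigeonhole-fibre g zero t {[]} _ _ t*0<0 = contradiction (subst (_< 0) (*-zeroʳ t) t*0<0) n≮0
    pigeonhole-fibre g zero t {x ∷ xs} _ (() ∷ _) _
    pigeonhole-fibre g (suc p) t {xs} uniq bounded t*p<len with t <? length (filter (λ x → g x ≟ p) xs)
    ... | yes t<fibre = p , _ , Unique.filter⁺ _ uniq , t<fibre , all-filter _ xs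
    ... | no  t≮fibre = pigeonhole-fibre g p t (Unique.filter⁺ (∁? P?) uniq)
                          (All.zipWith below (filter⁺ (∁? P?) bounded , all-filter (∁? P?) xs)) rest-large
      where
      P? : Decidable (λ x → g x ≡ p)
      P? x = g x ≟ p
      below : ∀ {x} → g x < suc p × g x ≢ p → g x < p
      below (g<1+p , g≢p) = ≤∧≢⇒< (m<1+n⇒m≤n g<1+p) g≢p
      rest-large : t * p < length (filter (∁? P?) xs)
      rest-large = +-cancelˡ-< t (t * p) _ (begin-strict
        t + t * p                   ≡⟨ *-suc t p ⟨
        t * suc p                   <⟨ t*p<len ⟩
        length xs                   ≡⟨ length-filter+∁ P? xs ⟩
        length (filter P? xs) + _   ≤⟨ +-monoˡ-≤ _ (≮⇒≥ t≮fibre) ⟩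
        t + length (filter (∁? P?) xs) ∎)
        where open ≤-Reasoning

  pigeonhole-injection : ∀ {n p} t (g : Fin n → Fin p) → t * p < n →
    ∃ λ (s : Fin (suc t) → Fin n) → Injective _≡_ _≡_ s × ∀ i → g (s i) ≡ g (s zero)
  pigeonhole-injection {n} {p} t g t*p<n
    with c , ys , uniq , t<|ys| , ys-inFibre ← pigeonhole-fibre (toℕ ∘ g) p t (Unique.allFin⁺ n)
           (tabulate⁺ (toℕ<n ∘ g)) (subst (t * p <_) (sym (length-tabulate (λ i → i))) t*p<n)
    = s , s-injective , λ i → toℕ-injective (trans (inFibre i) (sym (inFibre zero)))
    where
    s : Fin (suc t) → Fin n
    s i = lookup ys (inject≤ i t<|ys|)
    s-injective : Injective _≡_ _≡_ s
    s-injective eq = inject≤-injective t<|ys| t<|ys| _ _ (lookup-injective uniq eq)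
    inFibre : ∀ i → toℕ (g (s i)) ≡ c
    inFibre i = All.lookup ys-inFibre (∈-lookup (inject≤ i t<|ys|))

module LinearAlgebra {c ℓ : Level} (F : Field c ℓ) where

  open import Level using (_⊔_)
  open import Data.Nat using (zero; suc)
  open import Data.Fin using (Fin; zero; suc; punchIn)
  open import Data.Product using (∃; _×_; _,_)
  open import Data.Vec.Functional using (tail; insertAt)
  open import Function using (_∘_)
  open import Function.Definitions using (Injective)
  open import Data.Empty using (⊥)
  open import Data.Vec.Functional.Properties using (insertAt-lookup; insertAt-punchIn)
  open import Data.Fin.Properties using (sequence)
  open import Effect.Monad using (RawMonad)
  open import Relation.Nullary using (¬_; Dec; yes; no)
  open import Relation.Nullary.Negation using (¬¬-Monad; ¬¬-map; negated-stable; ¬∃⟶∀¬)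
  open import Relation.Nullary.Decidable using (¬¬-excluded-middle)
  import Relation.Binary.PropositionalEquality as ≡

  open Field F hiding (zero)

  open import Algebra.Properties.Ring ring using (-1*x≈-x; -‿distribˡ-*)
  open import Algebra.Properties.Semiring.Sum semiring
    using (sum; sum-cong-≋; sum-remove; ∑-distrib-+; *-distribʳ-sum; sum-replicate-zero)
  open import Relation.Binary.Reasoning.Setoid setoid

  LinearlyDependent : ∀ {r d} → (Fin r → Fin d → Carrier) → Set (c ⊔ ℓ)
  LinearlyDependent {r} v =
    ∃ λ (a : Fin r → Carrier) → (∀ i → sum (λ j → a j * v j i) ≈ 0#) × ∃ λ j → a j ≉ 0#

  dependent-tail : ∀ {r d} {v : Fin r → Fin (suc d) → Carrier} →
    (∀ j → v j zero ≈ 0#) → LinearlyDependent (λ j → tail (v j)) → LinearlyDependent v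
  dependent-tail {r} {v = v} v₀≈0 (a , vanish , nontrivial) = a , vanish′ , nontrivial
    where
    vanish′ : ∀ i → sum (λ j → a j * v j i) ≈ 0#
    vanish′ zero    = trans (sum-cong-≋ (λ j → trans (*-congˡ (v₀≈0 j)) (zeroʳ (a j))))
                            (sum-replicate-zero r)
    vanish′ (suc i) = vanish i

  dependent-addMultiple : ∀ {r d} {v : Fin (suc r) → Fin d → Carrier}
    (p : Fin (suc r)) (μ : Fin r → Carrier) →
    LinearlyDependent (λ j i → v (punchIn p j) i + μ j * v p i) → LinearlyDependent v
  dependent-addMultiple {v = v} p μ (a , vanish , j , aⱼ≉0) =
    b , vanish′ , punchIn p j , λ b≈0 → aⱼ≉0 (trans (reflexive (≡.sym (insertAt-punchIn a p t j))) b≈0)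
    where
    t : Carrier
    t = sum (λ j → a j * μ j)
    b : Fin _ → Carrier
    b = insertAt a p t
    distrib-shear : ∀ x y u w → (x * y) * w + x * u ≈ x * (u + y * w)
    distrib-shear x y u w = begin
      (x * y) * w + x * u   ≈⟨ +-congʳ (*-assoc x y w) ⟩
      x * (y * w) + x * u   ≈⟨ distribˡ x (y * w) u ⟨
      x * (y * w + u)       ≈⟨ *-congˡ (+-comm (y * w) u) ⟩
      x * (u + y * w)       ∎
    vanish′ : ∀ i → sum (λ x → b x * v x i) ≈ 0#
    vanish′ i = begin
      sum (λ x → b x * v x i)
        ≈⟨ sum-remove {i = p} (λ x → b x * v x i) ⟩
      b p * v p i + sum (λ j → b (punchIn p j) * v (punchIn p j) i)
        ≈⟨ +-cong (*-congʳ (reflexive (insertAt-lookup a p t)))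
                  (sum-cong-≋ λ j → *-congʳ (reflexive (insertAt-punchIn a p t j))) ⟩
      t * v p i + sum (λ j → a j * v (punchIn p j) i)
        ≈⟨ +-congʳ (*-distribʳ-sum (v p i) (λ j → a j * μ j)) ⟩
      sum (λ j → a j * μ j * v p i) + sum (λ j → a j * v (punchIn p j) i)
        ≈⟨ ∑-distrib-+ (λ j → a j * μ j * v p i) (λ j → a j * v (punchIn p j) i) ⟨
      sum (λ j → a j * μ j * v p i + a j * v (punchIn p j) i)
        ≈⟨ sum-cong-≋ (λ j → distrib-shear (a j) (μ j) (v (punchIn p j) i) (v p i)) ⟩
      sum (λ j → a j * (v (punchIn p j) i + μ j * v p i))
        ≈⟨ vanish i ⟩
      0# ∎

  open module ¬¬ {a} = RawMonad (¬¬-Monad {a}) using (pure; _<$>_; _>>=_; rawApplicative)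

  u+-[u*y]*x≈0 : ∀ {x y} → x * y ≈ 1# → ∀ u → u + - (u * y) * x ≈ 0#
  u+-[u*y]*x≈0 {x} {y} xy≈1 u = begin
    u + - (u * y) * x       ≈⟨ +-congˡ (-‿distribˡ-* (u * y) x) ⟨
    u + - ((u * y) * x)     ≈⟨ +-congˡ (-‿cong (*-assoc u y x)) ⟩
    u + - (u * (y * x))     ≈⟨ +-congˡ (-‿cong (*-congˡ (trans (*-comm y x) xy≈1))) ⟩
    u + - (u * 1#)          ≈⟨ +-congˡ (-‿cong (*-identityʳ u)) ⟩
    u + - u                 ≈⟨ -‿inverseʳ u ⟩
    0#                      ∎

  ¬¬-pivot : ∀ {r} (a : Fin (suc r) → Carrier) →
    ¬ ¬ ∃ λ p → ∃ λ (μ : Fin r → Carrier) → ∀ j → a (punchIn p j) + μ j * a p ≈ 0#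
  ¬¬-pivot a = negated-stable (¬¬-map pivotOrZero ¬¬-excluded-middle)
    where
    pivotOrZero : Dec (∃ λ p → a p ≉ 0#) → ¬ ¬ _
    pivotOrZero (yes (p , aₚ≉0)) with inverse (a p) aₚ≉0
    ... | y , aₚy≈1 = pure (p , (λ j → - (a (punchIn p j) * y)) , λ j → u+-[u*y]*x≈0 aₚy≈1 _)
    pivotOrZero (no ∄aₚ≉0) = ¬¬-map allZero (sequence rawApplicative (¬∃⟶∀¬ ∄aₚ≉0))
      where
      allZero : (∀ p → a p ≈ 0#) → _
      allZero a≈0 = zero , (λ _ → 0#) , λ j → trans (+-cong (a≈0 (suc j)) (zeroˡ (a zero))) (+-identityʳ 0#)

  -- Field equality is not decidable, so the pivot search, and with it the dependence of
  -- d + 1 vectors in F^d, only holds under double negation.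
  ¬¬-dependent : ∀ d (v : Fin (suc d) → Fin d → Carrier) → ¬ ¬ LinearlyDependent v
  ¬¬-dependent zero    v = pure ((λ _ → 1#) , (λ ()) , zero , λ 1≈0 → 0≉1 (sym 1≈0))
  ¬¬-dependent (suc d) v = do
    p , μ , cleared ← ¬¬-pivot (λ j → v j zero)
    let w = λ j i → v (punchIn p j) i + μ j * v p i
    dependent-addMultiple {v = v} p μ ∘ dependent-tail {v = w} cleared <$> ¬¬-dependent d (tail ∘ w)

  ¬¬-dependent-twoConstantCoordinates : ∀ d (v : Fin (suc (suc d)) → Fin (suc (suc d)) → Carrier) {x y} →
    (∀ j → v j zero ≈ x) → (∀ j → v j (suc zero) ≈ y) → ¬ ¬ LinearlyDependent v
  ¬¬-dependent-twoConstantCoordinates d v v₀≈x v₁≈y =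
    dependent-addMultiple {v = v} zero (λ _ → - 1#) ∘ dependent-tail {v = w} (cleared v₀≈x)
      ∘ dependent-tail {v = tail ∘ w} (cleared v₁≈y)
      <$> ¬¬-dependent d (tail ∘ tail ∘ w)
    where
    w : Fin (suc d) → Fin (suc (suc d)) → Carrier
    w j i = v (suc j) i + - 1# * v zero i
    cleared : ∀ {i z} → (∀ j → v j i ≈ z) → ∀ j → v (suc j) i + - 1# * v zero i ≈ 0#
    cleared {i} vᵢ≈z j = trans (+-cong (trans (vᵢ≈z (suc j)) (sym (vᵢ≈z zero))) (-1*x≈-x (v zero i)))
                               (-‿inverseʳ (v zero i))

  sumFin≡sum : ∀ m (f : Fin m → Carrier) → sumFin F m f ≡.≡ sum f
  sumFin≡sum zero    f = ≡.refl
  sumFin≡sum (suc m) f = ≡.cong (f zero +_) (sumFin≡sum m (f ∘ suc))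

  IsMDS⇒independent : ∀ {k n M} → IsMDS F k n M → (s : Fin k → Fin n) → Injective ≡._≡_ ≡._≡_ s →
    ¬ LinearlyDependent (λ j i → M i (s j))
  IsMDS⇒independent {k} mds s s-injective (a , vanish , j , aⱼ≉0) =
    aⱼ≉0 (mds s s-injective a (λ i → trans (reflexive (sumFin≡sum k _)) (vanish i)) j)

  IsMDS⇒columnsDifferInTwoRows : ∀ {d n M} → IsMDS F (suc (suc d)) n M →
    (s : Fin (suc (suc d)) → Fin n) → Injective ≡._≡_ ≡._≡_ s →
    (∀ j → M zero (s j) ≈ M zero (s zero)) → (∀ j → M (suc zero) (s j) ≈ M (suc zero) (s zero)) → ⊥
  IsMDS⇒columnsDifferInTwoRows {d} {M = M} mds s s-injective row₀ row₁ =
    ¬¬-dependent-twoConstantCoordinates d (λ j i → M i (s j)) row₀ row₁ (IsMDS⇒independent {M = M} mds s s-injective)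

open import Data.Nat using (ℕ; suc; _≤_; _*_; s≤s; z≤n)
open import Data.Nat.Properties using (≮⇒≥; ≤-<-trans; *-monoˡ-≤; n≤1+n)
open import Data.Fin using (Fin; zero; suc; combine)
open import Data.Fin.Properties using (combine-injective)
open import Data.Product using (∃; _×_; _,_; proj₁; proj₂)
open import Data.Empty using (⊥)
open import Relation.Binary.PropositionalEquality using (_≡_; cong)
open import Function.Definitions using (Injective)
open Pigeonhole using (pigeonhole-injection)

claim1p4 : ∀ {c ℓ : Level} (F : Field c ℓ) (k n : ℕ) → 2 ≤ k → k ≤ n →
    (M : Fin k → Fin n → Field.Carrier F) → IsMDS F k n M →
    (m : ℕ) (σ : Fin m → Field.Carrier F) → Injective _≡_ (Field._≈_ F) σ →
    (∀ i j → ∃ λ a → Field._≈_ F (M i j) (σ a)) →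
    n ≤ k * (m * m)
claim1p4 F (suc (suc d)) n (s≤s (s≤s z≤n)) _ M mds m σ _ entry = ≮⇒≥ λ k·m²<n →
  columnsAgreeingInTwoRows
    (pigeonhole-injection (suc d) indexPair (≤-<-trans (*-monoˡ-≤ (m * m) (n≤1+n (suc d))) k·m²<n))
  where
  open Field F using (_≈_; trans; sym; reflexive)
  open LinearAlgebra F using (IsMDS⇒columnsDifferInTwoRows)
  index : Fin (suc (suc d)) → Fin n → Fin m
  index i j = proj₁ (entry i j)
  indexPair : Fin n → Fin (m * m)
  indexPair j = combine (index zero j) (index (suc zero) j)
  indexPair-injective : ∀ {j j′} → indexPair j ≡ indexPair j′ →
    index zero j ≡ index zero j′ × index (suc zero) j ≡ index (suc zero) j′
  indexPair-injective {j} {j′} =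
    combine-injective (index zero j) (index (suc zero) j) (index zero j′) (index (suc zero) j′)
  sameEntry : ∀ {i j j′} → index i j ≡ index i j′ → M i j ≈ M i j′
  sameEntry {i} {j} {j′} eq =
    trans (proj₂ (entry i j)) (trans (reflexive (cong σ eq)) (sym (proj₂ (entry i j′))))
  columnsAgreeingInTwoRows :
    (∃ λ s → Injective _≡_ _≡_ s × ∀ j → indexPair (s j) ≡ indexPair (s zero)) → ⊥
  columnsAgreeingInTwoRows (s , s-injective , samePair) =
    IsMDS⇒columnsDifferInTwoRows {M = M} mds s s-injective
      (λ j → sameEntry (proj₁ (indexPair-injective (samePair j))))
      (λ j → sameEntry (proj₂ (indexPair-injective (samePair j))))
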